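{- Let $\pi\in\mathfrak{S}_n$. At any stage during the execution of the valid-factor algorithm described in the context, if the valid factor is $\pi_l\cdots\pi_r$, then $\pi_r,\pi_{r+1},\dots,\pi_n$ are all ascents of $\pi$; in particular $\pi_r<\pi_{r+1}<\cdots<\pi_n$.
   Context: One-line notation with $\pi_{n+1}=\infty$ (and $\pi_0=\infty$); a letter $\pi_i$ is an ascent if $\pi_i<\pi_{i+1}$ (so the last letter is always an ascent), and a peak if $\pi_{i-1}<\pi_i>\pi_{i+1}$. Valid-factor algorithm: maintain a valid factor $\pi_l\cdots\pi_r$, initially $l=1,r=n$. Let $x$ run through $n,n-1,\dots,1$; let $i$ be the position of $x$. If $l\le i\le r$: (a) if $x$ is a peak of $\pi$, record the factor $\pi_l\cdots\pi_i$ and set $l:=i+1$; (b) else if $i=l$, record $\pi_i\cdots\pi_n$, record $x$ as a rixed point if it is an ascent, and terminate; (c) otherwise (x is the last but not first letter of the valid factor) record $x$ as a rixed point and set $r:=i-1$. If $i\notin[l,r]$ nothing happens. -}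

module Defs where

open import Data.Nat using (ℕ; zero; suc; _+_; _∸_; _≤_; _<_)
open import Data.Fin using (Fin; toℕ)
open import Data.Fin.Permutation using (Permutation′; _⟨$⟩ʳ_; _⟨$⟩ˡ_)
open import Data.Product using (∃-syntax; _×_)
open import Relation.Binary.PropositionalEquality using (_≡_)
open import Relation.Nullary using (¬_)

-- Conventions: positions and values are 0-indexed elements of Fin n
-- (paper position i ↔ Fin index i-1, paper value x ↔ Fin value x-1);
-- π ⟨$⟩ʳ i is the value at position i, π ⟨$⟩ˡ x is the position of value x.

-- π_i is an ascent: π_i < π_{i+1}, where π_{n+1} = ∞ (so the last letter is
-- always an ascent: no position follows it).
Ascent : ∀ {n} → Permutation′ n → Fin n → Set
Ascent {n} π i = ∀ (j : Fin n) → toℕ j ≡ suc (toℕ i) → toℕ (π ⟨$⟩ʳ i) < toℕ (π ⟨$⟩ʳ j)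

-- π_i is a peak: π_{i-1} < π_i > π_{i+1} with π_0 = π_{n+1} = ∞
-- (so the first and last letters are never peaks).
Peak : ∀ {n} → Permutation′ n → Fin n → Set
Peak {n} π i =
  ∃[ h ] ∃[ j ] (suc (toℕ h) ≡ toℕ i × toℕ j ≡ suc (toℕ i)
    × toℕ (π ⟨$⟩ʳ h) < toℕ (π ⟨$⟩ʳ i) × toℕ (π ⟨$⟩ʳ j) < toℕ (π ⟨$⟩ʳ i))

-- A state of the valid-factor algorithm while it is running:
-- the valid factor is π_l ⋯ π_r (0-indexed positions l, r), and k is the
-- number of values not yet processed (the next value x to process is the one
-- with toℕ x + 1 ≡ k, i.e. x runs through n-1, …, 0).
record State : Set where
  constructor ⟨_,_,_⟩
  field
    l r k : ℕ

data Reachable {n : ℕ} (π : Permutation′ n) : State → Set where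
  start : Reachable π ⟨ 0 , n ∸ 1 , n ⟩
  skip-left : ∀ {l r} (x : Fin n) → Reachable π ⟨ l , r , suc (toℕ x) ⟩ →
    toℕ (π ⟨$⟩ˡ x) < l → Reachable π ⟨ l , r , toℕ x ⟩
  skip-right : ∀ {l r} (x : Fin n) → Reachable π ⟨ l , r , suc (toℕ x) ⟩ →
    r < toℕ (π ⟨$⟩ˡ x) → Reachable π ⟨ l , r , toℕ x ⟩
  peak : ∀ {l r} (x : Fin n) → Reachable π ⟨ l , r , suc (toℕ x) ⟩ →
    l ≤ toℕ (π ⟨$⟩ˡ x) → toℕ (π ⟨$⟩ˡ x) ≤ r → Peak π (π ⟨$⟩ˡ x) →
    Reachable π ⟨ suc (toℕ (π ⟨$⟩ˡ x)) , r , toℕ x ⟩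
  -- (b) i = l (and x not a peak): the algorithm terminates, no further state.
  -- (c) l < i ≤ r and x not a peak: record x as rixed point, set r := i-1
  shrink : ∀ {l r} (x : Fin n) → Reachable π ⟨ l , r , suc (toℕ x) ⟩ →
    l < toℕ (π ⟨$⟩ˡ x) → toℕ (π ⟨$⟩ˡ x) ≤ r → ¬ Peak π (π ⟨$⟩ˡ x) →
    Reachable π ⟨ l , toℕ (π ⟨$⟩ˡ x) ∸ 1 , toℕ x ⟩

-- Invariant: every letter in the valid factor π_l ⋯ π_r is still unprocessed
-- (smaller than every value already treated), and π_r, …, π_n are ascents.
-- When case (c) processes x at position i with l < i ≤ r, x is the maximum of
-- the factor, so its left neighbour is smaller; if also i < r its right
-- neighbour would be smaller too and x would be a peak.  Hence i = r, and the
-- new right end π_{i-1} < x = π_i is an ascent.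
module Submission where

open import Defs
open import Data.Nat using (ℕ; suc; _≤_; _<_; _∸_; z≤n; s≤s; s≤s⁻¹)
open import Data.Nat.Properties
open import Data.Fin using (Fin; toℕ; suc; inject₁; fromℕ<)
open import Data.Fin.Properties using (toℕ-injective; toℕ-inject₁; toℕ-fromℕ<; toℕ<n)
open import Data.Fin.Permutation using (Permutation′; _⟨$⟩ʳ_; _⟨$⟩ˡ_; inverseʳ; inverseˡ)
open import Data.Product using (Σ; _×_; _,_)
open import Data.Sum using (_⊎_; inj₁; inj₂; [_,_])
open import Relation.Nullary using (¬_; contradiction)
open import Relation.Binary.PropositionalEquality using (_≡_; _≢_; refl; sym; trans; cong; subst)

predecessor : ∀ {n} (i : Fin n) → 0 < toℕ i → Σ (Fin n) λ h → suc (toℕ h) ≡ toℕ i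
predecessor (suc i) _ = inject₁ i , cong suc (toℕ-inject₁ i)

successor : ∀ {n} (i : Fin n) → suc (toℕ i) < n → Σ (Fin n) λ j → toℕ j ≡ suc (toℕ i)
successor i 1+i<n = fromℕ< 1+i<n , toℕ-fromℕ< 1+i<n

<∸1⇒suc< : ∀ {m n} → m < n ∸ 1 → suc m < n
<∸1⇒suc< {n = suc n} m<n = s≤s m<n

last-is-ascent : ∀ {n} (π : Permutation′ n) j → n ∸ 1 ≤ toℕ j → Ascent π j
last-is-ascent {suc m} π j m≤j j′ j′≡1+j =
  contradiction (s≤s⁻¹ (subst (_< suc m) j′≡1+j (toℕ<n j′))) (≤⇒≯ m≤j)

ascent-of-<-next : ∀ {n} (π : Permutation′ n) h i → suc (toℕ h) ≡ toℕ i →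
  toℕ (π ⟨$⟩ʳ h) < toℕ (π ⟨$⟩ʳ i) → Ascent π h
ascent-of-<-next π h i 1+h≡i πh<πi j j≡1+h =
  subst (λ q → toℕ (π ⟨$⟩ʳ h) < toℕ (π ⟨$⟩ʳ q))
        (toℕ-injective (trans (sym 1+h≡i) (sym j≡1+h))) πh<πi

module _ {n : ℕ} (π : Permutation′ n) where

  FactorBelow : ℕ → ℕ → ℕ → Set
  FactorBelow l r k = ∀ p → l ≤ toℕ p → toℕ p ≤ r → toℕ (π ⟨$⟩ʳ p) < k

  value-at-position : ∀ x → toℕ (π ⟨$⟩ʳ (π ⟨$⟩ˡ x)) ≡ toℕ x
  value-at-position x = cong toℕ (inverseʳ π)

  value<-off-position : ∀ x p → p ≢ π ⟨$⟩ˡ x →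
    toℕ (π ⟨$⟩ʳ p) < suc (toℕ x) → toℕ (π ⟨$⟩ʳ p) < toℕ x
  value<-off-position x p p≢ πp<1+x with m<1+n⇒m<n∨m≡n πp<1+x
  ... | inj₁ πp<x = πp<x
  ... | inj₂ πp≡x = contradiction p≡ p≢
    where
    p≡ : p ≡ π ⟨$⟩ˡ x
    p≡ = trans (sym (inverseˡ π)) (cong (π ⟨$⟩ˡ_) (toℕ-injective πp≡x))

  FactorBelow-next : ∀ {l r l′ r′} x → FactorBelow l r (suc (toℕ x)) →
    l ≤ l′ → r′ ≤ r → toℕ (π ⟨$⟩ˡ x) < l′ ⊎ r′ < toℕ (π ⟨$⟩ˡ x) →
    FactorBelow l′ r′ (toℕ x)
  FactorBelow-next x below l≤l′ r′≤r outside p l′≤p p≤r′ =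
    value<-off-position x p p≢ (below p (≤-trans l≤l′ l′≤p) (≤-trans p≤r′ r′≤r))
    where
    p≢ : p ≢ π ⟨$⟩ˡ x
    p≢ refl = [ (λ i<l′ → <⇒≱ i<l′ l′≤p) , (λ r′<i → <⇒≱ r′<i p≤r′) ] outside

  neighbour<-max : ∀ {l r} x p → FactorBelow l r (suc (toℕ x)) →
    l ≤ toℕ p → toℕ p ≤ r → toℕ p ≢ toℕ (π ⟨$⟩ˡ x) →
    toℕ (π ⟨$⟩ʳ p) < toℕ (π ⟨$⟩ʳ (π ⟨$⟩ˡ x))
  neighbour<-max x p below l≤p p≤r p≢ =
    subst (toℕ (π ⟨$⟩ʳ p) <_) (sym (value-at-position x))
      (value<-off-position x p (λ e → p≢ (cong toℕ e)) (below p l≤p p≤r))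

  left-neighbour<-max : ∀ {l r} x h → FactorBelow l r (suc (toℕ x)) →
    l < toℕ (π ⟨$⟩ˡ x) → toℕ (π ⟨$⟩ˡ x) ≤ r → suc (toℕ h) ≡ toℕ (π ⟨$⟩ˡ x) →
    toℕ (π ⟨$⟩ʳ h) < toℕ (π ⟨$⟩ʳ (π ⟨$⟩ˡ x))
  left-neighbour<-max {l} x h below l<i i≤r 1+h≡i =
    neighbour<-max x h below (s≤s⁻¹ (subst (suc l ≤_) (sym 1+h≡i) l<i))
      (≤-trans (n≤1+n _) (≤-trans (≤-reflexive 1+h≡i) i≤r)) (<⇒≢ (≤-reflexive 1+h≡i))

  right-neighbour<-max : ∀ {l r} x j → FactorBelow l r (suc (toℕ x)) →
    l ≤ toℕ (π ⟨$⟩ˡ x) → toℕ (π ⟨$⟩ˡ x) < r → toℕ j ≡ suc (toℕ (π ⟨$⟩ˡ x)) →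
    toℕ (π ⟨$⟩ʳ j) < toℕ (π ⟨$⟩ʳ (π ⟨$⟩ˡ x))
  right-neighbour<-max x j below l≤i i<r j≡1+i =
    neighbour<-max x j below (≤-trans l≤i (≤-trans (n≤1+n _) (≤-reflexive (sym j≡1+i))))
      (≤-trans (≤-reflexive j≡1+i) i<r) (λ j≡i → <⇒≢ (≤-reflexive (sym j≡1+i)) (sym j≡i))

  interior-max-is-peak : ∀ {l r} x → FactorBelow l r (suc (toℕ x)) → r ≤ n ∸ 1 →
    l < toℕ (π ⟨$⟩ˡ x) → toℕ (π ⟨$⟩ˡ x) < r → Peak π (π ⟨$⟩ˡ x)
  interior-max-is-peak x below r≤n∸1 l<i i<r
    with predecessor (π ⟨$⟩ˡ x) (≤-<-trans z≤n l<i)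
       | successor (π ⟨$⟩ˡ x) (<∸1⇒suc< (<-≤-trans i<r r≤n∸1))
  ... | h , 1+h≡i | j , j≡1+i = h , j , 1+h≡i , j≡1+i ,
    left-neighbour<-max x h below l<i (<⇒≤ i<r) 1+h≡i ,
    right-neighbour<-max x j below (<⇒≤ l<i) i<r j≡1+i

  record Invariant (l r k : ℕ) : Set where
    field
      r≤n∸1 : r ≤ n ∸ 1
      factor-below : FactorBelow l r k
      ascents-from : ∀ j → r ≤ toℕ j → Ascent π j

  open Invariant

  Invariant-next : ∀ {l r l′ r′} x → Invariant l r (suc (toℕ x)) →
    l ≤ l′ → r′ ≤ r → toℕ (π ⟨$⟩ˡ x) < l′ ⊎ r′ < toℕ (π ⟨$⟩ˡ x) →
    (∀ j → r′ ≤ toℕ j → Ascent π j) → Invariant l′ r′ (toℕ x)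
  Invariant-next x I l≤l′ r′≤r outside ascents = record
    { r≤n∸1 = ≤-trans r′≤r (r≤n∸1 I)
    ; factor-below = FactorBelow-next x (factor-below I) l≤l′ r′≤r outside
    ; ascents-from = ascents
    }

  Invariant-next-same-r : ∀ {l r l′} x → Invariant l r (suc (toℕ x)) →
    l ≤ l′ → toℕ (π ⟨$⟩ˡ x) < l′ ⊎ r < toℕ (π ⟨$⟩ˡ x) → Invariant l′ r (toℕ x)
  Invariant-next-same-r x I l≤l′ outside = Invariant-next x I l≤l′ ≤-refl outside (ascents-from I)

  shrink-preserves : ∀ {l r} x → Invariant l r (suc (toℕ x)) →
    l < toℕ (π ⟨$⟩ˡ x) → toℕ (π ⟨$⟩ˡ x) ≤ r → ¬ Peak π (π ⟨$⟩ˡ x) →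
    Invariant l (toℕ (π ⟨$⟩ˡ x) ∸ 1) (toℕ x)
  shrink-preserves {l} {r} x I l<i i≤r ¬peak
    with predecessor (π ⟨$⟩ˡ x) (≤-<-trans z≤n l<i)
  ... | h , 1+h≡i = subst (λ r′ → Invariant l r′ (toℕ x)) (cong (_∸ 1) 1+h≡i)
    (Invariant-next x I ≤-refl h≤r (inj₂ (≤-reflexive 1+h≡i)) ascents)
    where
    i : Fin n
    i = π ⟨$⟩ˡ x
    h≤r : toℕ h ≤ r
    h≤r = ≤-trans (n≤1+n _) (≤-trans (≤-reflexive 1+h≡i) i≤r)
    i≡r : toℕ i ≡ r
    i≡r = ≤∧≮⇒≡ i≤r (λ i<r → ¬peak
      (interior-max-is-peak x (factor-below I) (r≤n∸1 I) l<i i<r))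
    ascents : ∀ j → toℕ h ≤ toℕ j → Ascent π j
    ascents j h≤j with m≤n⇒m<n∨m≡n h≤j
    ... | inj₁ h<j = ascents-from I j
      (≤-trans (≤-reflexive (trans (sym i≡r) (sym 1+h≡i))) h<j)
    ... | inj₂ h≡j = subst (Ascent π) (toℕ-injective h≡j)
      (ascent-of-<-next π h i 1+h≡i (left-neighbour<-max x h (factor-below I) l<i i≤r 1+h≡i))

  reachable-invariant : ∀ {l r k} → Reachable π ⟨ l , r , k ⟩ → Invariant l r k
  reachable-invariant start = record
    { r≤n∸1 = ≤-refl
    ; factor-below = λ p _ _ → toℕ<n (π ⟨$⟩ʳ p)
    ; ascents-from = last-is-ascent π
    }
  reachable-invariant (skip-left x R i<l) =
    Invariant-next-same-r x (reachable-invariant R) ≤-refl (inj₁ i<l)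
  reachable-invariant (skip-right x R r<i) =
    Invariant-next-same-r x (reachable-invariant R) ≤-refl (inj₂ r<i)
  reachable-invariant (peak x R l≤i _ _) =
    Invariant-next-same-r x (reachable-invariant R) (≤-trans l≤i (n≤1+n _)) (inj₁ ≤-refl)
  reachable-invariant (shrink x R l<i i≤r ¬peak) =
    shrink-preserves x (reachable-invariant R) l<i i≤r ¬peak

lemma9 : ∀ {n : ℕ} (π : Permutation′ n) (l r k : ℕ) →
    Reachable π ⟨ l , r , k ⟩ →
    (∀ (j : Fin n) → r ≤ toℕ j → Ascent π j)
    × (∀ (i j : Fin n) → r ≤ toℕ i → toℕ j ≡ suc (toℕ i) →
         toℕ (π ⟨$⟩ʳ i) < toℕ (π ⟨$⟩ʳ j))
lemma9 {n} π l r k R = ascents , λ i j r≤i j≡1+i → ascents i r≤i j j≡1+i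
  where
  ascents : ∀ (j : Fin n) → r ≤ toℕ j → Ascent π j
  ascents = Invariant.ascents-from (reachable-invariant π R)
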